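{- Let $a,b,c,\ell,m,w$ be positive integers such that $\ell a=mb+c=w$ and $b\neq c$. Let $\boldsymbol{\lambda}$ be the partition of $w$ consisting of $\ell$ copies of $a$, let $\boldsymbol{\mu}$ be the partition of $w$ consisting of $m$ copies of $b$ and one copy of $c$, and let $\Gamma$ be a directed cycle of length $w$. Then $\eta_{\boldsymbol{\lambda}\boldsymbol{\mu}}(\Gamma)=a$.
   Context: A partition of $w$ is a multiset of positive integers with sum $w$. A cycle digraph is a disjoint union of finitely many directed cycles of length $\ge1$. For a cycle digraph $\Gamma$ with $w$ vertices and a partition $\boldsymbol{\lambda}$ of $w$, a $\boldsymbol{\lambda}$-tiling of $\Gamma$ is a set $S$ of subgraphs of $\Gamma$, each a directed path of length $\ge0$, whose vertex sets partition $V(\Gamma)$, and such that the multiset $\{|V(\gamma)|:\gamma\in S\}$ equals $\boldsymbol{\lambda}$. A $(\boldsymbol{\lambda},\boldsymbol{\mu})$-tiling is an ordered pair $(S,T)$ with $S$ a $\boldsymbol{\lambda}$-tiling and $T$ a $\boldsymbol{\mu}$-tiling of $\Gamma$; an isomorphism $(\Gamma,S,T)\to(\Gamma',S',T')$ is a digraph isomorphism carrying $S$ onto $S'$ and $T$ onto $T'$. $(S,T)$ is admissible if $(\Gamma,S,T)$ has no nontrivial automorphisms; $(S,T)$ and $(S',T')$ are isomorphic if there is an isomorphism $(\Gamma,S,T)\to(\Gamma,S',T')$. $\eta_{\boldsymbol{\lambda}\boldsymbol{\mu}}(\Gamma)$ denotes the number of isomorphism classes of admissible $(\boldsymbol{\lambda},\boldsymbol{\mu})$-tilings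 of $\Gamma$. -}

module Defs where

open import Data.Nat using (ℕ; zero; suc)
open import Data.Fin using (Fin; toℕ)
open import Data.Fin.Permutation using (Permutation′; _⟨$⟩ʳ_)
open import Data.List using (List; []; _∷_; map; concat; length; allFin; replicate)
open import Data.List.Relation.Unary.All using (All)
open import Data.List.Relation.Unary.Any using (Any)
open import Data.List.Relation.Unary.AllPairs using (AllPairs)
open import Data.List.Relation.Unary.Unique.Propositional using (Unique)
open import Data.List.Relation.Unary.Linked using (Linked)
open import Data.List.Relation.Binary.Permutation.Propositional using (_↭_)
open import Data.Product using (Σ; _×_; _,_)
open import Data.Sum using (_⊎_)
open import Relation.Binary.PropositionalEquality using (_≡_; _≢_)
open import Relation.Nullary using (¬_)
open import Function.Bundles using (_⇔_)

record Digraph : Set₁ where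
  field
    size : ℕ
    edge : Fin size → Fin size → Set
open Digraph public

-- The directed cycle of length w: vertices 0..w-1, edges i → i+1 (mod w).
-- For w = 1 this is a single vertex with a loop.
DirectedCycle : ℕ → Digraph
DirectedCycle w = record
  { size = w
  ; edge = λ i j → (suc (toℕ i) ≡ toℕ j) ⊎ (suc (toℕ i) ≡ w × toℕ j ≡ zero)
  }

-- A directed path subgraph (length ≥ 0) of G, given by its vertex sequence
-- v₀ → v₁ → … → vₖ (k ≥ 0): nonempty, distinct vertices, consecutive edges.
-- (A path subgraph is determined by, and determines, this sequence.)
IsPath : (G : Digraph) → List (Fin (size G)) → Set
IsPath G vs = (vs ≢ []) × Unique vs × Linked (edge G) vs

-- A finite set of paths (listed; order irrelevant up to ↭).
Tiling : Digraph → Set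
Tiling G = List (List (Fin (size G)))

-- S is a λ-tiling of G: each member is a path, vertex sets partition V(G),
-- and the multiset of vertex counts equals the partition λ (a multiset = list up to ↭).
IsTiling : (G : Digraph) → List ℕ → Tiling G → Set
IsTiling G λp S =
  All (IsPath G) S × (concat S ↭ allFin (size G)) × (map length S ↭ λp)

IsDigraphIso : (G : Digraph) → Permutation′ (size G) → Set
IsDigraphIso G φ = ∀ i j → edge G i j ⇔ edge G (φ ⟨$⟩ʳ i) (φ ⟨$⟩ʳ j)

mapTiling : {G : Digraph} → Permutation′ (size G) → Tiling G → Tiling G
mapTiling φ S = map (map (φ ⟨$⟩ʳ_)) S

IsTriple-Iso : (G : Digraph) → Permutation′ (size G) →
               Tiling G → Tiling G → Tiling G → Tiling G → Set
IsTriple-Iso G φ S T S' T' =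
  IsDigraphIso G φ × (mapTiling {G} φ S ↭ S') × (mapTiling {G} φ T ↭ T')

IsoTilings : (G : Digraph) → Tiling G × Tiling G → Tiling G × Tiling G → Set
IsoTilings G (S , T) (S' , T') =
  Σ (Permutation′ (size G)) λ φ → IsTriple-Iso G φ S T S' T'

AdmissibleTiling : (G : Digraph) → List ℕ → List ℕ → Tiling G × Tiling G → Set
AdmissibleTiling G λp μp (S , T) =
  IsTiling G λp S × IsTiling G μp T ×
  (∀ (φ : Permutation′ (size G)) → IsTriple-Iso G φ S T S T → ∀ i → φ ⟨$⟩ʳ i ≡ i)

-- η_{λμ}(G) = k : there are k admissible (λ,μ)-tilings, pairwise non-isomorphic,
-- such that every admissible (λ,μ)-tiling is isomorphic to one of them
-- (i.e. the number of isomorphism classes of admissible tilings is k).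
η-is : (G : Digraph) → List ℕ → List ℕ → ℕ → Set
η-is G λp μp k =
  Σ (List (Tiling G × Tiling G)) λ L →
    (length L ≡ k) ×
    All (AdmissibleTiling G λp μp) L ×
    AllPairs (λ p q → ¬ IsoTilings G p q) L ×
    (∀ p → AdmissibleTiling G λp μp p → Any (IsoTilings G p) L)

-- Every path tiling of a directed cycle arises by cutting the cycle at some vertex s into
-- consecutive arcs, and the automorphisms of the cycle are exactly its rotations. Since μ
-- has a single part c ≠ b, rotating the c-arc of T to vertex 0 turns T into one fixed
-- tiling T₀; an automorphism preserving T must fix its c-arc, hence is the identity, so
-- every (λ,μ)-tiling is admissible. After that rotation S cuts the cycle into arcs of
-- length a starting at some r, which matters only mod a because ℓ a = w; the a tilings
-- for 0 ≤ r < a are pairwise non-isomorphic, as an isomorphism between them fixes T₀ and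
-- is therefore the identity.
module Submission where

open import Defs
open import Data.Nat using (ℕ; zero; suc; _*_; _+_; _<_; _≤_; _∸_; z≤n; s≤s; NonZero; >-nonZero)
open import Data.Nat.Properties
open import Data.Nat.DivMod
open import Data.Nat.Induction using (<-wellFounded)
open import Data.Nat.ListAction using (sum)
open import Data.Nat.Solver using (module +-*-Solver)
open import Data.Fin using (Fin; toℕ)
open import Data.Fin.Properties using (toℕ-injective; toℕ<n; toℕ-fromℕ<)
open import Data.Fin.Permutation using (Permutation′; _⟨$⟩ʳ_)
open import Data.List using (List; []; _∷_; _++_; _∷ʳ_; map; concat; length; allFin; replicate; tabulate)
open import Data.List.Properties
  using (tabulate-cong; length-++; length-tabulate; length-map; length-replicate; map-cong; map-id)
open import Data.List.Relation.Unary.All as All using (All; []; _∷_)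
open import Data.List.Relation.Unary.Any as Any using (Any; here; there)
open import Data.List.Relation.Unary.AllPairs as AllPairs using (AllPairs; []; _∷_)
open import Data.List.Relation.Unary.Linked using (Linked; []; [-]; _∷_)
import Data.List.Relation.Unary.All.Properties as AllP
import Data.List.Relation.Unary.AllPairs.Properties as AllPairsP
open import Data.List.Relation.Unary.Unique.Propositional.Properties using (allFin⁺)
open import Data.List.Membership.Propositional using (_∈_)
open import Data.List.Membership.Propositional.Properties
  using (∈-∃++; ∈-concat⁻′; ∈-concat⁺′; ∈-map⁻; ∈-map⁺; ∈-allFin)
open import Data.List.Relation.Binary.Permutation.Propositional
  using (_↭_; ↭-refl; ↭-sym; ↭-trans; ↭-prep; ↭-reflexive; module PermutationReasoning)
open import Data.List.Relation.Binary.Permutation.Propositional.Properties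
  using (↭-empty-inv; ↭-length; ++⁺ˡ; shift; shifts; drop-∷; ∷↭∷ʳ; ∈-resp-↭; All-resp-↭; map⁺)
open import Data.Product using (Σ; _×_; _,_)
open import Data.Sum using (inj₁; inj₂)
open import Data.Empty using (⊥-elim)
open import Induction.WellFounded using (Acc; acc)
open import Relation.Binary.PropositionalEquality
open import Function.Bundles using (Equivalence; mk⇔; mk↔ₛ′)

private
  variable
    A : Set
    x : A
    xs ys zs : List A

concat-↭ : {xss yss : List (List A)} → xss ↭ yss → concat xss ↭ concat yss
concat-↭ _↭_.refl = ↭-refl
concat-↭ (_↭_.prep xs p) = ++⁺ˡ xs (concat-↭ p)
concat-↭ (_↭_.swap xs ys p) = ↭-trans (shifts xs ys) (++⁺ˡ ys (++⁺ˡ xs (concat-↭ p)))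
concat-↭ (_↭_.trans p q) = ↭-trans (concat-↭ p) (concat-↭ q)

++-cancelˡ-↭ : ∀ (xs : List A) → xs ++ ys ↭ xs ++ zs → ys ↭ zs
++-cancelˡ-↭ [] p = p
++-cancelˡ-↭ (x ∷ xs) p = ++-cancelˡ-↭ xs (drop-∷ p)

∈⇒↭∷ : x ∈ xs → Σ (List A) λ ys → xs ↭ x ∷ ys
∈⇒↭∷ {x = x} x∈xs with ys , zs , refl ← ∈-∃++ x∈xs = ys ++ zs , shift x ys zs

↭-replicate⁻ : ∀ k → xs ↭ replicate k x → xs ≡ replicate k x
↭-replicate⁻ {xs = xs} {x = x} k p =
  all-equal xs k (All-resp-↭ (↭-sym p) (AllP.replicate⁺ k refl)) (trans (↭-length p) (length-replicate k))
  where
  all-equal : ∀ xs k → All (_≡ x) xs → length xs ≡ k → xs ≡ replicate k x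
  all-equal [] zero _ _ = refl
  all-equal (y ∷ ys) (suc k) (refl ∷ ys≡x) e = cong (y ∷_) (all-equal ys k ys≡x (suc-injective e))

∈-replicate⁺ : ∀ {k} → 0 < k → x ∈ replicate k x
∈-replicate⁺ {k = suc k} _ = here refl

replicate-∷ʳ : ∀ k (x : A) → replicate k x ∷ʳ x ≡ x ∷ replicate k x
replicate-∷ʳ zero x = refl
replicate-∷ʳ (suc k) x = cong (x ∷_) (replicate-∷ʳ k x)

sum-replicate : ∀ k x → sum (replicate k x) ≡ k * x
sum-replicate zero x = refl
sum-replicate (suc k) x = cong (x +_) (sum-replicate k x)

mapTiling-id : (G : Digraph) (φ : Permutation′ (size G)) → (∀ i → φ ⟨$⟩ʳ i ≡ i) →
               ∀ S → mapTiling {G} φ S ≡ S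
mapTiling-id G φ fix S = trans (map-cong (λ p → trans (map-cong fix p) (map-id p)) S) (map-id S)

module Cycle (n : ℕ) where

  N : ℕ
  N = suc n

  C : Digraph
  C = DirectedCycle N

  ⟦_⟧ : ℕ → Fin N
  ⟦ k ⟧ = k mod N

  toℕ-⟦⟧ : ∀ k → toℕ ⟦ k ⟧ ≡ k % N
  toℕ-⟦⟧ k = toℕ-fromℕ< (m%n<n k N)

  ⟦⟧≡⇒%≡ : ∀ x y → ⟦ x ⟧ ≡ ⟦ y ⟧ → x % N ≡ y % N
  ⟦⟧≡⇒%≡ x y e = trans (sym (toℕ-⟦⟧ x)) (trans (cong toℕ e) (toℕ-⟦⟧ y))

  %≡⇒⟦⟧≡ : ∀ x y → x % N ≡ y % N → ⟦ x ⟧ ≡ ⟦ y ⟧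
  %≡⇒⟦⟧≡ x y e = toℕ-injective (trans (toℕ-⟦⟧ x) (trans e (sym (toℕ-⟦⟧ y))))

  ⟦toℕ⟧ : ∀ i → ⟦ toℕ i ⟧ ≡ i
  ⟦toℕ⟧ i = toℕ-injective (trans (toℕ-⟦⟧ (toℕ i)) (m<n⇒m%n≡m (toℕ<n i)))

  ⟦+*N⟧ : ∀ x k → ⟦ x + k * N ⟧ ≡ ⟦ x ⟧
  ⟦+*N⟧ x k = %≡⇒⟦⟧≡ (x + k * N) x ([m+kn]%n≡m%n x k N)

  ⟦+N⟧ : ∀ x → ⟦ x + N ⟧ ≡ ⟦ x ⟧
  ⟦+N⟧ x = %≡⇒⟦⟧≡ (x + N) x ([m+n]%n≡m%n x N)

  ⟦⟧-congˡ : ∀ k {x y} → ⟦ x ⟧ ≡ ⟦ y ⟧ → ⟦ k + x ⟧ ≡ ⟦ k + y ⟧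
  ⟦⟧-congˡ k {x} {y} e = %≡⇒⟦⟧≡ (k + x) (k + y) (begin
    (k + x) % N           ≡⟨ %-distribˡ-+ k x N ⟩
    (k % N + x % N) % N   ≡⟨ cong (λ z → (k % N + z) % N) (⟦⟧≡⇒%≡ x y e) ⟩
    (k % N + y % N) % N   ≡⟨ %-distribˡ-+ k y N ⟨
    (k + y) % N           ∎)
    where open ≡-Reasoning

  ⟦⟧-congʳ : ∀ k {x y} → ⟦ x ⟧ ≡ ⟦ y ⟧ → ⟦ x + k ⟧ ≡ ⟦ y + k ⟧
  ⟦⟧-congʳ k {x} {y} e =
    subst₂ (λ u v → ⟦ u ⟧ ≡ ⟦ v ⟧) (+-comm k x) (+-comm k y) (⟦⟧-congˡ k e)

  n*k+[k+x]≡x+k*N : ∀ k x → n * k + (k + x) ≡ x + k * N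
  n*k+[k+x]≡x+k*N k x = solve 3 (λ n k x → n :* k :+ (k :+ x) := x :+ k :* (con 1 :+ n)) refl n k x
    where open +-*-Solver

  -- Adding n * k after k adds a multiple of N, which undoes the shift by k.
  ⟦⟧-cancelˡ : ∀ k {x y} → ⟦ k + x ⟧ ≡ ⟦ k + y ⟧ → ⟦ x ⟧ ≡ ⟦ y ⟧
  ⟦⟧-cancelˡ k {x} {y} e = begin
    ⟦ x ⟧                 ≡⟨ ⟦+*N⟧ x k ⟨
    ⟦ x + k * N ⟧         ≡⟨ cong ⟦_⟧ (n*k+[k+x]≡x+k*N k x) ⟨
    ⟦ n * k + (k + x) ⟧   ≡⟨ ⟦⟧-congˡ (n * k) e ⟩
    ⟦ n * k + (k + y) ⟧   ≡⟨ cong ⟦_⟧ (n*k+[k+x]≡x+k*N k y) ⟩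
    ⟦ y + k * N ⟧         ≡⟨ ⟦+*N⟧ y k ⟩
    ⟦ y ⟧                 ∎
    where open ≡-Reasoning

  ⟦⟧-injective-< : ∀ {x y} → x < N → y < N → ⟦ x ⟧ ≡ ⟦ y ⟧ → x ≡ y
  ⟦⟧-injective-< {x} {y} x<N y<N e = trans (sym (m<n⇒m%n≡m x<N)) (trans (⟦⟧≡⇒%≡ x y e) (m<n⇒m%n≡m y<N))

  ⟦+⟧-injective : ∀ t {i j} → i < N → j < N → ⟦ t + i ⟧ ≡ ⟦ t + j ⟧ → i ≡ j
  ⟦+⟧-injective t i<N j<N e = ⟦⟧-injective-< i<N j<N (⟦⟧-cancelˡ t e)

  next : Fin N → Fin N
  next i = ⟦ suc (toℕ i) ⟧

  next-⟦⟧ : ∀ k → next ⟦ k ⟧ ≡ ⟦ suc k ⟧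
  next-⟦⟧ k = ⟦⟧-congˡ 1 (⟦toℕ⟧ ⟦ k ⟧)

  edge⇒next : ∀ {i j} → edge C i j → j ≡ next i
  edge⇒next {i} {j} (inj₁ e) = trans (sym (⟦toℕ⟧ j)) (cong ⟦_⟧ (sym e))
  edge⇒next {i} {j} (inj₂ (e₁ , e₂)) = begin
    j                  ≡⟨ ⟦toℕ⟧ j ⟨
    ⟦ toℕ j ⟧          ≡⟨ cong ⟦_⟧ e₂ ⟩
    ⟦ 0 ⟧              ≡⟨ ⟦+N⟧ 0 ⟨
    ⟦ N ⟧              ≡⟨ cong ⟦_⟧ e₁ ⟨
    ⟦ suc (toℕ i) ⟧    ∎
    where open ≡-Reasoning

  next-edge : ∀ i → edge C i (next i)
  next-edge i with m≤n⇒m<n∨m≡n (toℕ<n i)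
  ... | inj₁ i+1<N = inj₁ (sym (trans (toℕ-⟦⟧ (suc (toℕ i))) (m<n⇒m%n≡m i+1<N)))
  ... | inj₂ i+1≡N = inj₂ (i+1≡N , trans (toℕ-⟦⟧ (suc (toℕ i))) (trans (cong (_% N) i+1≡N) (n%n≡0 N)))

  ⟦⟧-edge : ∀ k → edge C ⟦ k ⟧ ⟦ suc k ⟧
  ⟦⟧-edge k = subst (edge C ⟦ k ⟧) (next-⟦⟧ k) (next-edge ⟦ k ⟧)

  -- path s k has k vertices, i.e. length k ∸ 1 in the sense of the paper.
  path : ℕ → ℕ → List (Fin N)
  path s zero = []
  path s (suc k) = ⟦ s ⟧ ∷ path (suc s) k

  paths : ℕ → List ℕ → Tiling C
  paths s [] = []
  paths s (k ∷ L) = path s k ∷ paths (s + k) L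

  path-cong : ∀ {s s'} k → ⟦ s ⟧ ≡ ⟦ s' ⟧ → path s k ≡ path s' k
  path-cong zero e = refl
  path-cong (suc k) e = cong₂ _∷_ e (path-cong k (⟦⟧-congˡ 1 e))

  paths-cong : ∀ {s s'} L → ⟦ s ⟧ ≡ ⟦ s' ⟧ → paths s L ≡ paths s' L
  paths-cong [] e = refl
  paths-cong {s} {s'} (k ∷ L) e = cong₂ _∷_ (path-cong k e) (paths-cong L (⟦⟧-congʳ k {s} {s'} e))

  path-head : ∀ {s s'} k → 0 < k → path s k ≡ path s' k → ⟦ s ⟧ ≡ ⟦ s' ⟧
  path-head (suc k) _ e = cong (λ { [] → ⟦ 0 ⟧ ; (v ∷ _) → v }) e

  length-path : ∀ s k → length (path s k) ≡ k
  length-path s zero = refl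
  length-path s (suc k) = cong suc (length-path (suc s) k)

  map-length-paths : ∀ s L → map length (paths s L) ≡ L
  map-length-paths s [] = refl
  map-length-paths s (k ∷ L) = cong₂ _∷_ (length-path s k) (map-length-paths (s + k) L)

  path-++ : ∀ s i j → path s (i + j) ≡ path s i ++ path (s + i) j
  path-++ s zero j = cong (λ z → path z j) (sym (+-identityʳ s))
  path-++ s (suc i) j = cong (⟦ s ⟧ ∷_) (trans (path-++ (suc s) i j)
                          (cong (λ z → path (suc s) i ++ path z j) (sym (+-suc s i))))

  paths-++ : ∀ s L L' → paths s (L ++ L') ≡ paths s L ++ paths (s + sum L) L'
  paths-++ s [] L' = cong (λ z → paths z L') (sym (+-identityʳ s))
  paths-++ s (k ∷ L) L' = cong (path s k ∷_) (trans (paths-++ (s + k) L L')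
                            (cong (λ z → paths (s + k) L ++ paths z L') (+-assoc s k (sum L))))

  concat-paths : ∀ s L → concat (paths s L) ≡ path s (sum L)
  concat-paths s [] = refl
  concat-paths s (k ∷ L) =
    trans (cong (path s k ++_) (concat-paths (s + k) L)) (sym (path-++ s k (sum L)))

  ∈-path⁻ : ∀ {v} s k → v ∈ path s k → Σ ℕ λ j → j < k × v ≡ ⟦ s + j ⟧
  ∈-path⁻ s (suc k) (here refl) = 0 , s≤s z≤n , cong ⟦_⟧ (sym (+-identityʳ s))
  ∈-path⁻ s (suc k) (there v∈) with j , j<k , e ← ∈-path⁻ (suc s) k v∈ =
    suc j , s≤s j<k , trans e (cong ⟦_⟧ (sym (+-suc s j)))

  ∈-path⁺ : ∀ s k {j} → j < k → ⟦ s + j ⟧ ∈ path s k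
  ∈-path⁺ s (suc k) {zero} _ = here (cong ⟦_⟧ (+-identityʳ s))
  ∈-path⁺ s (suc k) {suc j} (s≤s j<k) =
    there (subst (_∈ path (suc s) k) (cong ⟦_⟧ (sym (+-suc s j))) (∈-path⁺ (suc s) k j<k))

  path-unique : ∀ s k → k ≤ N → AllPairs _≢_ (path s k)
  path-unique s zero _ = []
  path-unique s (suc k) k<N = All.tabulate head-fresh ∷ path-unique (suc s) k (<⇒≤ k<N)
    where
    head-fresh : ∀ {v} → v ∈ path (suc s) k → ⟦ s ⟧ ≢ v
    head-fresh v∈ s≡v with j , j<k , e ← ∈-path⁻ (suc s) k v∈ =
      0≢1+n (⟦+⟧-injective s (s≤s z≤n) (<-≤-trans (s≤s j<k) k<N)
        (trans (cong ⟦_⟧ (+-identityʳ s)) (trans s≡v (trans e (cong ⟦_⟧ (sym (+-suc s j)))))))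

  path-linked : ∀ s k → Linked (edge C) (path s k)
  path-linked s zero = []
  path-linked s (suc zero) = [-]
  path-linked s (suc (suc k)) = ⟦⟧-edge s ∷ path-linked (suc s) (suc k)

  path-IsPath : ∀ s {k} → 0 < k → k ≤ N → IsPath C (path s k)
  path-IsPath s {suc k} _ k≤N = (λ ()) , path-unique s (suc k) k≤N , path-linked s (suc k)

  linked⇒path : ∀ v vs → Linked (edge C) (v ∷ vs) → v ∷ vs ≡ path (toℕ v) (suc (length vs))
  linked⇒path v [] _ = cong (_∷ []) (sym (⟦toℕ⟧ v))
  linked⇒path v (u ∷ us) (e ∷ l) = cong₂ _∷_ (sym (⟦toℕ⟧ v))
    (trans (linked⇒path u us l) (path-cong (suc (length us)) (trans (⟦toℕ⟧ u) (edge⇒next e))))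

  IsArc : List (Fin N) → Set
  IsArc p = Σ ℕ λ s → Σ ℕ λ k → 0 < k × p ≡ path s k

  IsPath⇒IsArc : ∀ {p} → IsPath C p → IsArc p
  IsPath⇒IsArc {[]} (p≢[] , _ , _) = ⊥-elim (p≢[] refl)
  IsPath⇒IsArc {v ∷ vs} (_ , _ , l) = toℕ v , suc (length vs) , s≤s z≤n , linked⇒path v vs l

  path-rotate : ∀ s → path s N ↭ path (suc s) N
  path-rotate s = begin
    ⟦ s ⟧ ∷ path (suc s) n              ↭⟨ ∷↭∷ʳ ⟦ s ⟧ (path (suc s) n) ⟩
    path (suc s) n ∷ʳ ⟦ s ⟧             ≡⟨ cong (path (suc s) n ∷ʳ_) (⟦+N⟧ s) ⟨
    path (suc s) n ∷ʳ ⟦ s + N ⟧         ≡⟨ cong (λ z → path (suc s) n ∷ʳ ⟦ z ⟧) (+-suc s n) ⟩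
    path (suc s) n ++ path (suc s + n) 1 ≡⟨ path-++ (suc s) n 1 ⟨
    path (suc s) (n + 1)                ≡⟨ cong (path (suc s)) (+-comm n 1) ⟩
    path (suc s) N                      ∎
    where open PermutationReasoning

  path-allFin : ∀ s → path s N ↭ allFin N
  path-allFin zero = ↭-reflexive (trans (path-tabulate 0 N) (tabulate-cong ⟦toℕ⟧))
    where
    path-tabulate : ∀ s k → path s k ≡ tabulate {n = k} (λ i → ⟦ s + toℕ i ⟧)
    path-tabulate s zero = refl
    path-tabulate s (suc k) = cong₂ _∷_ (cong ⟦_⟧ (sym (+-identityʳ s)))
      (trans (path-tabulate (suc s) k) (tabulate-cong (λ i → cong ⟦_⟧ (sym (+-suc s (toℕ i))))))
  path-allFin (suc s) = ↭-trans (↭-sym (path-rotate s)) (path-allFin s)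

  paths-IsTiling : ∀ s {L} → All (λ k → 0 < k × k ≤ N) L → sum L ≡ N → IsTiling C L (paths s L)
  paths-IsTiling s {L} bounds sumL≡N =
    arcs s bounds ,
    ↭-trans (↭-reflexive (trans (concat-paths s L) (cong (path s) sumL≡N))) (path-allFin s) ,
    ↭-reflexive (map-length-paths s L)
    where
    arcs : ∀ s {L} → All (λ k → 0 < k × k ≤ N) L → All (IsPath C) (paths s L)
    arcs s [] = []
    arcs s {k ∷ _} ((0<k , k≤N) ∷ bounds) = path-IsPath s 0<k k≤N ∷ arcs (s + k) bounds

  paths-rotate : ∀ s k L → sum (k ∷ L) ≡ N → paths s (k ∷ L) ↭ paths (s + k) (L ∷ʳ k)
  paths-rotate s k L sum≡N = begin
    path s k ∷ paths (s + k) L                       ↭⟨ ∷↭∷ʳ (path s k) (paths (s + k) L) ⟩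
    paths (s + k) L ∷ʳ path s k                      ≡⟨ cong (paths (s + k) L ∷ʳ_) (path-cong k wrap) ⟩
    paths (s + k) L ++ paths (s + k + sum L) (k ∷ []) ≡⟨ paths-++ (s + k) L (k ∷ []) ⟨
    paths (s + k) (L ∷ʳ k)                           ∎
    where
    open PermutationReasoning
    wrap : ⟦ s ⟧ ≡ ⟦ s + k + sum L ⟧
    wrap = sym (trans (cong ⟦_⟧ (trans (+-assoc s k (sum L)) (cong (s +_) sum≡N))) (⟦+N⟧ s))

  covered : ∀ {U t M p v} → concat U ↭ path t M → v ∈ p → p ∈ U → Σ ℕ λ i → i < M × v ≡ ⟦ t + i ⟧
  covered {t = t} {M} cover v∈p p∈U = ∈-path⁻ t M (∈-resp-↭ cover (∈-concat⁺′ v∈p p∈U))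

  -- The tile through ⟦ t ⟧ starts there: otherwise it would also contain the predecessor
  -- of ⟦ t ⟧, which lies outside the covered arc because the arc is shorter than the cycle.
  first-tile : ∀ {U t M} → suc M < N → All IsArc U → concat U ↭ path t (suc M) →
               Σ ℕ λ k → 0 < k × path t k ∈ U
  first-tile {U} {t} {M} M+1<N arcs cover
    with p , t∈p , p∈U ← ∈-concat⁻′ U (∈-resp-↭ (↭-sym cover) (here refl))
    with s , k , 0<k , refl ← All.lookup arcs p∈U
    with ∈-path⁻ s k t∈p
  ... | zero , _ , t≡s =
    k , 0<k , subst (_∈ U) (path-cong k (trans (cong ⟦_⟧ (sym (+-identityʳ s))) (sym t≡s))) p∈U
  ... | suc j , j<k , t≡s+j+1
    with i , i<M+1 , s+j≡t+i ← covered cover (∈-path⁺ s k (<-trans (n<1+n j) j<k)) p∈U =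
    ⊥-elim (1+n≢0 (⟦+⟧-injective t (≤-<-trans i<M+1 M+1<N) (s≤s z≤n) (begin
      ⟦ t + suc i ⟧      ≡⟨ cong ⟦_⟧ (+-suc t i) ⟩
      ⟦ suc (t + i) ⟧    ≡⟨ ⟦⟧-congˡ 1 s+j≡t+i ⟨
      ⟦ suc (s + j) ⟧    ≡⟨ cong ⟦_⟧ (+-suc s j) ⟨
      ⟦ s + suc j ⟧      ≡⟨ t≡s+j+1 ⟨
      ⟦ t ⟧              ≡⟨ cong ⟦_⟧ (+-identityʳ t) ⟨
      ⟦ t + 0 ⟧          ∎)))
    where open ≡-Reasoning

  first-tile-fits : ∀ {U t M k} → M < N → concat U ↭ path t M → path t k ∈ U → k ≤ M
  first-tile-fits {t = t} {M} {k} M<N cover p∈U = ≮⇒≥ λ M<k →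
    let i , i<M , t+M≡t+i = covered cover (∈-path⁺ t k M<k) p∈U
    in <⇒≢ i<M (sym (⟦+⟧-injective t M<N (<-trans i<M M<N) t+M≡t+i))

  concat≡[]⇒≡[] : ∀ {U} → All IsArc U → concat U ≡ [] → U ≡ []
  concat≡[]⇒≡[] [] _ = refl
  concat≡[]⇒≡[] ((s , suc k , _ , refl) ∷ _) ()

  cover⇒paths : ∀ {U t M} → Acc _<_ M → M < N → All IsArc U → concat U ↭ path t M →
                Σ (List ℕ) λ L → U ↭ paths t L
  cover⇒paths {M = zero} _ _ arcs cover = [] , ↭-reflexive (concat≡[]⇒≡[] arcs (↭-empty-inv cover))
  cover⇒paths {U} {t} {suc M} (acc smaller) M<N arcs cover
    with k , 0<k , p∈U ← first-tile M<N arcs cover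
    with U' , U↭ ← ∈⇒↭∷ p∈U =
    let k≤M+1 = first-tile-fits M<N cover p∈U
        arcs' = All.tail (All-resp-↭ U↭ arcs)
        L , U'↭ = cover⇒paths (smaller (∸-monoʳ-< 0<k k≤M+1)) (≤-<-trans (m∸n≤m (suc M) k) M<N)
                    arcs' (rest k≤M+1)
    in k ∷ L , ↭-trans U↭ (↭-prep (path t k) U'↭)
    where
    rest : k ≤ suc M → concat U' ↭ path (t + k) (suc M ∸ k)
    rest k≤M+1 = ++-cancelˡ-↭ (path t k) (begin
      path t k ++ concat U'                  ↭⟨ concat-↭ U↭ ⟨
      concat U                               ↭⟨ cover ⟩
      path t (suc M)                         ≡⟨ cong (path t) (m+[n∸m]≡n k≤M+1) ⟨
      path t (k + (suc M ∸ k))               ≡⟨ path-++ t k (suc M ∸ k) ⟩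
      path t k ++ path (t + k) (suc M ∸ k)   ∎)
      where open PermutationReasoning

  tiling⇒paths : ∀ {U p} → All (IsPath C) U → concat U ↭ allFin N → p ∈ U →
                 Σ ℕ λ s → Σ (List ℕ) λ L → U ↭ paths s (length p ∷ L)
  tiling⇒paths {U} pathsU cover p∈U
    with s , k , 0<k , refl ← IsPath⇒IsArc (All.lookup pathsU p∈U)
    with U' , U↭ ← ∈⇒↭∷ p∈U
    rewrite length-path s k =
    let arcs' = All.tail (All-resp-↭ U↭ (All.map IsPath⇒IsArc pathsU))
        L , U'↭ = cover⇒paths (<-wellFounded (N ∸ k)) (∸-monoʳ-< 0<k k≤N) arcs' rest
    in s , L , ↭-trans U↭ (↭-prep (path s k) U'↭)
    where
    k+|U'|≡N : k + length (concat U') ≡ N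
    k+|U'|≡N = begin
      k + length (concat U')                    ≡⟨ cong (_+ length (concat U')) (length-path s k) ⟨
      length (path s k) + length (concat U')    ≡⟨ length-++ (path s k) ⟨
      length (path s k ++ concat U')            ≡⟨ ↭-length (concat-↭ U↭) ⟨
      length (concat U)                         ≡⟨ ↭-length cover ⟩
      length (allFin N)                    ≡⟨ length-tabulate {n = N} (λ i → i) ⟩
      N                                    ∎
      where open ≡-Reasoning
    k≤N : k ≤ N
    k≤N = subst (k ≤_) k+|U'|≡N (m≤m+n k _)
    rest : concat U' ↭ path (s + k) (N ∸ k)
    rest = ++-cancelˡ-↭ (path s k) (begin
      path s k ++ concat U'                  ↭⟨ concat-↭ U↭ ⟨
      concat U                               ↭⟨ cover ⟩
      allFin N                               ↭⟨ path-allFin s ⟨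
      path s N                               ≡⟨ cong (path s) (m+[n∸m]≡n k≤N) ⟨
      path s (k + (N ∸ k))                   ≡⟨ path-++ s k (N ∸ k) ⟩
      path s k ++ path (s + k) (N ∸ k)       ∎)
      where open PermutationReasoning

  tiling-cut-at : ∀ {λp U k} → IsTiling C λp U → k ∈ λp →
                  Σ ℕ λ s → Σ (List ℕ) λ L → U ↭ paths s (k ∷ L) × k ∷ L ↭ λp
  tiling-cut-at {λp} {U} (pathsU , cover , lengths) k∈λ
    with p , p∈U , refl ← ∈-map⁻ length (∈-resp-↭ (↭-sym lengths) k∈λ)
    with s , L , U↭ ← tiling⇒paths pathsU cover p∈U =
    s , L , U↭ , (begin
      length p ∷ L                         ≡⟨ map-length-paths s (length p ∷ L) ⟨
      map length (paths s (length p ∷ L))  ↭⟨ map⁺ length U↭ ⟨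
      map length U                         ↭⟨ lengths ⟩
      λp                                   ∎)
    where open PermutationReasoning

  map-paths-shift : ∀ (f : Fin N → Fin N) d → (∀ k → f ⟦ k ⟧ ≡ ⟦ d + k ⟧) →
                    ∀ s L → map (map f) (paths s L) ≡ paths (d + s) L
  map-paths-shift f d f-shift = map-paths
    where
    map-path : ∀ s k → map f (path s k) ≡ path (d + s) k
    map-path s zero = refl
    map-path s (suc k) = cong₂ _∷_ (f-shift s) (trans (map-path (suc s) k) (cong (λ z → path z k) (+-suc d s)))
    map-paths : ∀ s L → map (map f) (paths s L) ≡ paths (d + s) L
    map-paths s [] = refl
    map-paths s (k ∷ L) = cong₂ _∷_ (map-path s k)
      (trans (map-paths (s + k) L) (cong (λ z → paths z L) (sym (+-assoc d s k))))

  automorphism-shift : ∀ {φ} → IsDigraphIso C φ → ∀ k → φ ⟨$⟩ʳ ⟦ k ⟧ ≡ ⟦ toℕ (φ ⟨$⟩ʳ ⟦ 0 ⟧) + k ⟧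
  automorphism-shift {φ} iso zero =
    sym (trans (cong ⟦_⟧ (+-identityʳ (toℕ (φ ⟨$⟩ʳ ⟦ 0 ⟧)))) (⟦toℕ⟧ (φ ⟨$⟩ʳ ⟦ 0 ⟧)))
  automorphism-shift {φ} iso (suc k) = begin
    φ ⟨$⟩ʳ ⟦ suc k ⟧          ≡⟨ edge⇒next (Equivalence.to (iso ⟦ k ⟧ ⟦ suc k ⟧) (⟦⟧-edge k)) ⟩
    next (φ ⟨$⟩ʳ ⟦ k ⟧)       ≡⟨ cong next (automorphism-shift {φ} iso k) ⟩
    next ⟦ d + k ⟧            ≡⟨ next-⟦⟧ (d + k) ⟩
    ⟦ suc (d + k) ⟧           ≡⟨ cong ⟦_⟧ (+-suc d k) ⟨
    ⟦ d + suc k ⟧             ∎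
    where
    open ≡-Reasoning
    d : ℕ
    d = toℕ (φ ⟨$⟩ʳ ⟦ 0 ⟧)

  automorphism-fixing-0 : ∀ {φ} → IsDigraphIso C φ → φ ⟨$⟩ʳ ⟦ 0 ⟧ ≡ ⟦ 0 ⟧ → ∀ i → φ ⟨$⟩ʳ i ≡ i
  automorphism-fixing-0 {φ} iso fix i = begin
    φ ⟨$⟩ʳ i                           ≡⟨ cong (φ ⟨$⟩ʳ_) (⟦toℕ⟧ i) ⟨
    φ ⟨$⟩ʳ ⟦ toℕ i ⟧                   ≡⟨ automorphism-shift {φ} iso (toℕ i) ⟩
    ⟦ toℕ (φ ⟨$⟩ʳ ⟦ 0 ⟧) + toℕ i ⟧     ≡⟨ cong (λ v → ⟦ toℕ v + toℕ i ⟧) fix ⟩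
    ⟦ toℕ ⟦ 0 ⟧ + toℕ i ⟧              ≡⟨ ⟦toℕ⟧ i ⟩
    i                                  ∎
    where open ≡-Reasoning

  rotate : ℕ → Fin N → Fin N
  rotate d i = ⟦ d + toℕ i ⟧

  rotate-⟦⟧ : ∀ d k → rotate d ⟦ k ⟧ ≡ ⟦ d + k ⟧
  rotate-⟦⟧ d k = ⟦⟧-congˡ d (⟦toℕ⟧ ⟦ k ⟧)

  rotate-edge : ∀ d {i j} → edge C i j → edge C (rotate d i) (rotate d j)
  rotate-edge d {i} {j} e = subst (edge C (rotate d i)) (sym rotate-j) (next-edge (rotate d i))
    where
    open ≡-Reasoning
    rotate-j : rotate d j ≡ next (rotate d i)
    rotate-j = begin
      rotate d j                ≡⟨ cong (rotate d) (edge⇒next e) ⟩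
      rotate d ⟦ suc (toℕ i) ⟧  ≡⟨ rotate-⟦⟧ d (suc (toℕ i)) ⟩
      ⟦ d + suc (toℕ i) ⟧       ≡⟨ cong ⟦_⟧ (+-suc d (toℕ i)) ⟩
      ⟦ suc (d + toℕ i) ⟧       ≡⟨ next-⟦⟧ (d + toℕ i) ⟨
      next (rotate d i)         ∎

  rotate-inverse : ∀ x y d → x + y ≡ d * N → ∀ i → rotate x (rotate y i) ≡ i
  rotate-inverse x y d x+y≡dN i = begin
    rotate x (rotate y i)      ≡⟨ rotate-⟦⟧ x (y + toℕ i) ⟩
    ⟦ x + (y + toℕ i) ⟧        ≡⟨ cong ⟦_⟧ (+-assoc x y (toℕ i)) ⟨
    ⟦ x + y + toℕ i ⟧          ≡⟨ cong (λ z → ⟦ z + toℕ i ⟧) x+y≡dN ⟩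
    ⟦ d * N + toℕ i ⟧          ≡⟨ cong ⟦_⟧ (+-comm (d * N) (toℕ i)) ⟩
    ⟦ toℕ i + d * N ⟧          ≡⟨ ⟦+*N⟧ (toℕ i) d ⟩
    ⟦ toℕ i ⟧                  ≡⟨ ⟦toℕ⟧ i ⟩
    i                          ∎
    where open ≡-Reasoning

  n*d+d≡d*N : ∀ d → n * d + d ≡ d * N
  n*d+d≡d*N d = trans (+-comm (n * d) d) (*-comm N d)

  rotation : ℕ → Permutation′ N
  rotation d = mk↔ₛ′ (rotate d) (rotate (n * d))
    (rotate-inverse d (n * d) d (*-comm N d))
    (rotate-inverse (n * d) d d (n*d+d≡d*N d))

  rotation-IsDigraphIso : ∀ d → IsDigraphIso C (rotation d)
  rotation-IsDigraphIso d i j = mk⇔ (rotate-edge d) λ e →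
    subst₂ (edge C) (rotate-inverse (n * d) d d (n*d+d≡d*N d) i)
                    (rotate-inverse (n * d) d d (n*d+d≡d*N d) j)
                    (rotate-edge (n * d) e)

  rotation-paths : ∀ d s L → mapTiling {C} (rotation d) (paths s L) ≡ paths (d + s) L
  rotation-paths d = map-paths-shift (rotate d) d (rotate-⟦⟧ d)

  ∈-paths-replicate : ∀ {p} s k x → p ∈ paths s (replicate k x) →
                      Σ ℕ λ j → j < k × p ≡ path (s + j * x) x
  ∈-paths-replicate s (suc k) x (here refl) = 0 , s≤s z≤n , cong (λ z → path z x) (sym (+-identityʳ s))
  ∈-paths-replicate s (suc k) x (there p∈) with j , j<k , e ← ∈-paths-replicate (s + x) k x p∈ =
    suc j , s≤s j<k , trans e (cong (λ z → path z x) (+-assoc s x (j * x)))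

  paths-replicate-period : ∀ s {k x} → 0 < k → k * x ≡ N →
                           paths s (replicate k x) ↭ paths (s + x) (replicate k x)
  paths-replicate-period s {suc k} {x} _ kx≡N = begin
    paths s (x ∷ replicate k x)          ↭⟨ paths-rotate s x (replicate k x) sum≡N ⟩
    paths (s + x) (replicate k x ∷ʳ x)   ≡⟨ cong (paths (s + x)) (replicate-∷ʳ k x) ⟩
    paths (s + x) (x ∷ replicate k x)    ∎
    where
    open PermutationReasoning
    sum≡N : x + sum (replicate k x) ≡ N
    sum≡N = trans (cong (x +_) (sum-replicate k x)) kx≡N

  paths-replicate-shift : ∀ r q {k x} → 0 < k → k * x ≡ N →
                          paths (r + q * x) (replicate k x) ↭ paths r (replicate k x)
  paths-replicate-shift r zero _ _ = ↭-reflexive (cong (λ z → paths z _) (+-identityʳ r))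
  paths-replicate-shift r (suc q) {k} {x} 0<k kx≡N = begin
    paths (r + (x + q * x)) R   ≡⟨ cong (λ z → paths z R) (trans (cong (r +_) (+-comm x (q * x)))
                                                                 (sym (+-assoc r (q * x) x))) ⟩
    paths (r + q * x + x) R     ↭⟨ paths-replicate-period (r + q * x) 0<k kx≡N ⟨
    paths (r + q * x) R         ↭⟨ paths-replicate-shift r q 0<k kx≡N ⟩
    paths r R                   ∎
    where
    open PermutationReasoning
    R : List ℕ
    R = replicate k x

  paths-replicate-mod : ∀ s {k x} .{{_ : NonZero x}} → 0 < k → k * x ≡ N →
                        paths s (replicate k x) ↭ paths (s % x) (replicate k x)
  paths-replicate-mod s {x = x} 0<k kx≡N =
    ↭-trans (↭-reflexive (cong (λ z → paths z _) (m≡m%n+[m/n]*n s x)))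
            (paths-replicate-shift (s % x) (s / x) 0<k kx≡N)

  paths-replicate-injective : ∀ {k x r r'} → 0 < k → 0 < x → k * x ≡ N → r < x → r' < x →
                              paths r (replicate k x) ↭ paths r' (replicate k x) → r ≡ r'
  paths-replicate-injective {suc k} {x} {r} {r'} _ 0<x kx≡N r<x r'<x R↭R
    with j , j<k , path-r≡ ← ∈-paths-replicate r' (suc k) x (∈-resp-↭ R↭R (here refl)) =
    same-offset j (⟦⟧-injective-< (<-≤-trans r<x x≤N) (r'+jx<N j<k) (path-head x 0<x path-r≡))
    where
    x≤N : x ≤ N
    x≤N = subst (x ≤_) kx≡N (m≤m+n x (k * x))
    r'+jx<N : ∀ {j} → j < suc k → r' + j * x < N
    r'+jx<N {j} j<k = <-≤-trans (+-monoˡ-< (j * x) r'<x) (subst (suc j * x ≤_) kx≡N (*-monoˡ-≤ x j<k))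
    same-offset : ∀ j → r ≡ r' + j * x → r ≡ r'
    same-offset zero r≡r' = trans r≡r' (+-identityʳ r')
    same-offset (suc j) r≡r'+x+jx =
      ⊥-elim (<⇒≱ r<x (subst (x ≤_) (sym r≡r'+x+jx) (≤-trans (m≤m+n x (j * x)) (m≤n+m _ r'))))

module Proposition (n a b c ℓ m : ℕ) (0<a : 0 < a) (0<b : 0 < b) (0<c : 0 < c) (0<ℓ : 0 < ℓ)
                   (0<m : 0 < m) (ℓa≡N : ℓ * a ≡ suc n) (mb+c≡N : m * b + c ≡ suc n) (b≢c : b ≢ c) where

  open Cycle n

  instance
    a-nonZero : NonZero a
    a-nonZero = >-nonZero 0<a

  Λ : List ℕ
  Λ = replicate ℓ a

  Μ : List ℕ
  Μ = c ∷ replicate m b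

  T₀ : Tiling C
  T₀ = paths 0 Μ

  representative : Fin a → Tiling C × Tiling C
  representative r = paths (toℕ r) Λ , T₀

  Λ-tiling : ∀ s → IsTiling C Λ (paths s Λ)
  Λ-tiling s = paths-IsTiling s (AllP.replicate⁺ ℓ (0<a , a≤N)) (trans (sum-replicate ℓ a) ℓa≡N)
    where
    a≤N : a ≤ N
    a≤N = subst (a ≤_) ℓa≡N (m≤n*m a ℓ {{>-nonZero 0<ℓ}})

  T₀-tiling : IsTiling C Μ T₀
  T₀-tiling = paths-IsTiling 0 ((0<c , c≤N) ∷ AllP.replicate⁺ m (0<b , b≤N)) sumΜ≡N
    where
    c≤N : c ≤ N
    c≤N = subst (c ≤_) mb+c≡N (m≤n+m c (m * b))
    b≤N : b ≤ N
    b≤N = subst (b ≤_) mb+c≡N (≤-trans (m≤n*m b m {{>-nonZero 0<m}}) (m≤m+n (m * b) c))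
    sumΜ≡N : c + sum (replicate m b) ≡ N
    sumΜ≡N = trans (cong (c +_) (sum-replicate m b)) (trans (+-comm c (m * b)) mb+c≡N)

  c-tile-unique : ∀ {p} → p ∈ T₀ → length p ≡ c → p ≡ path 0 c
  c-tile-unique (here refl) _ = refl
  c-tile-unique (there p∈) |p|≡c with _ , _ , refl ← ∈-paths-replicate c m b p∈ =
    ⊥-elim (b≢c (trans (sym (length-path _ b)) |p|≡c))

  T₀-rigid : ∀ {φ} → IsDigraphIso C φ → mapTiling {C} φ T₀ ↭ T₀ → ∀ i → φ ⟨$⟩ʳ i ≡ i
  T₀-rigid {φ} iso φT₀↭T₀ = automorphism-fixing-0 {φ} iso φ0≡0
    where
    d : ℕ
    d = toℕ (φ ⟨$⟩ʳ ⟦ 0 ⟧)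
    φT₀ : mapTiling {C} φ T₀ ≡ paths (d + 0) Μ
    φT₀ = map-paths-shift (φ ⟨$⟩ʳ_) d (automorphism-shift {φ} iso) 0 Μ
    moved-c-tile : path (d + 0) c ∈ T₀
    moved-c-tile = ∈-resp-↭ φT₀↭T₀ (subst (path (d + 0) c ∈_) (sym φT₀) (here refl))
    φ0≡0 : φ ⟨$⟩ʳ ⟦ 0 ⟧ ≡ ⟦ 0 ⟧
    φ0≡0 = trans (automorphism-shift {φ} iso 0)
                 (path-head c 0<c (c-tile-unique moved-c-tile (length-path (d + 0) c)))

  representative-admissible : ∀ r → AdmissibleTiling C Λ Μ (representative r)
  representative-admissible r =
    Λ-tiling (toℕ r) , T₀-tiling , λ φ (iso , _ , φT₀↭T₀) → T₀-rigid {φ} iso φT₀↭T₀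

  representatives-distinct : ∀ {r r'} → IsoTilings C (representative r) (representative r') → r ≡ r'
  representatives-distinct {r} {r'} (φ , iso , φS↭S' , φT₀↭T₀) =
    toℕ-injective (paths-replicate-injective 0<ℓ 0<a ℓa≡N (toℕ<n r) (toℕ<n r')
      (subst (_↭ paths (toℕ r') Λ) (mapTiling-id C φ (T₀-rigid {φ} iso φT₀↭T₀) _) φS↭S'))

  rotated-to-representative : ∀ {S T s s'} → S ↭ paths s' Λ → T ↭ paths s Μ →
                              IsoTilings C (S , T) (representative ((n * s + s') mod a))
  rotated-to-representative {S} {T} {s} {s'} S↭ T↭ =
    rotation (n * s) , rotation-IsDigraphIso (n * s) , S-part , T-part
    where
    open PermutationReasoning
    S-part : mapTiling {C} (rotation (n * s)) S ↭ paths (toℕ ((n * s + s') mod a)) Λ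
    S-part = begin
      map (map (rotate (n * s))) S            ↭⟨ map⁺ (map (rotate (n * s))) S↭ ⟩
      map (map (rotate (n * s))) (paths s' Λ) ≡⟨ rotation-paths (n * s) s' Λ ⟩
      paths (n * s + s') Λ                    ↭⟨ paths-replicate-mod (n * s + s') 0<ℓ ℓa≡N ⟩
      paths ((n * s + s') % a) Λ              ≡⟨ cong (λ z → paths z Λ) (toℕ-fromℕ< (m%n<n (n * s + s') a)) ⟨
      paths (toℕ ((n * s + s') mod a)) Λ      ∎
    T-part : mapTiling {C} (rotation (n * s)) T ↭ T₀
    T-part = begin
      map (map (rotate (n * s))) T            ↭⟨ map⁺ (map (rotate (n * s))) T↭ ⟩
      map (map (rotate (n * s))) (paths s Μ)  ≡⟨ rotation-paths (n * s) s Μ ⟩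
      paths (n * s + s) Μ                     ≡⟨ paths-cong Μ (trans (cong ⟦_⟧ (n*d+d≡d*N s)) (⟦+*N⟧ 0 s)) ⟩
      paths 0 Μ                               ∎

  representatives-complete : ∀ p → AdmissibleTiling C Λ Μ p →
                             Any (IsoTilings C p) (map representative (allFin a))
  representatives-complete (S , T) (S-tiling , T-tiling , _)
    with s , L , T↭ , c∷L↭Μ ← tiling-cut-at T-tiling (here refl)
    with s' , L' , S↭ , a∷L'↭Λ ← tiling-cut-at S-tiling (∈-replicate⁺ 0<ℓ) =
    Any.map (λ { refl → rotated-to-representative S↭Λ T↭Μ }) (∈-map⁺ representative (∈-allFin _))
    where
    S↭Λ : S ↭ paths s' Λ
    S↭Λ = subst (λ z → S ↭ paths s' z) (↭-replicate⁻ ℓ a∷L'↭Λ) S↭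
    T↭Μ : T ↭ paths s Μ
    T↭Μ = subst (λ z → T ↭ paths s (c ∷ z)) (↭-replicate⁻ m (drop-∷ c∷L↭Μ)) T↭

  η≡a : η-is C Λ Μ a
  η≡a = map representative (allFin a)
      , trans (length-map representative (allFin a)) (length-tabulate {n = a} (λ r → r))
      , AllP.map⁺ (All.universal representative-admissible (allFin a))
      , AllPairsP.map⁺ (AllPairs.map (λ r≢r' ≅ → r≢r' (representatives-distinct ≅)) (allFin⁺ a))
      , representatives-complete

proposition2p3 : (a b c ℓ m w : ℕ) → 0 < a → 0 < b → 0 < c → 0 < ℓ → 0 < m → 0 < w →
    ℓ * a ≡ w → m * b + c ≡ w → b ≢ c →
    η-is (DirectedCycle w) (replicate ℓ a) (c ∷ replicate m b) a
proposition2p3 a b c ℓ m (suc n) 0<a 0<b 0<c 0<ℓ 0<m _ ℓa≡w mb+c≡w b≢c =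
  Proposition.η≡a n a b c ℓ m 0<a 0<b 0<c 0<ℓ 0<m ℓa≡w mb+c≡w b≢c
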